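{- Let $x^Z$ be an optimal solution of an instance of the incremental knapsack problem and let $V^Z=\sum_{i,t}v_i\Delta_tx^Z_{i,t}$ be its value. Then either there is a period $1<t^{[3]}<T$ such that (a) $\frac13V^Z\le\sum_{t=t^{[3]}}^T\sum_iv_i\Delta_tx^Z_{i,t}$ and (b) $\frac13V^Z\le\sum_{t=1}^{t^{[3]}-1}\sum_iv_i\Delta_tx^Z_{i,t}$, or there is a feasible replicated-knapsack solution (at some period) with value at least $V^Z/3$.
   Context: Incremental knapsack problem: $T$ periods with capacities $B_1\le\dots\le B_T$, discount factors $\Delta_t>0$, $N$ items with values $v_i>0$ and weights $w_i>0$; a feasible solution is $x\in\{0,1\}^{N\times T}$ with $x_{i,t-1}\le x_{i,t}$ ($t\ge2$) and $\sum_iw_ix_{i,t}\le B_t$ for all $t$; its value is $\sum_{t,i}v_i\Delta_tx_{i,t}$. For $1\le\bar t\le T$, a 0-1 vector $\bar x$ is a replicated-knapsack solution at $\bar t$ if $\bar x_{i,t}=0$ for all $i$ and $t<\bar t$, and $\bar x_{i,t}=\bar x_{i,\bar t}$ for all $i$ and $t\ge\bar t$.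
   Formalization: The capacities, discount factors, item values and item weights of the incremental knapsack instance are rational. -}

module Defs where

open import Data.Nat using (ℕ; zero; suc)
open import Data.Fin using (Fin; toℕ) renaming (zero to fzero; suc to fsuc)
open import Data.Bool using (Bool; true; false; if_then_else_)
open import Data.Rational using (ℚ; 0ℚ; _+_; _*_; _≤_; _<_)
open import Data.Product using (Σ; _×_; _,_)
open import Relation.Binary.PropositionalEquality using (_≡_)
import Data.Nat as N
import Data.Bool as B

sumFin : {n : ℕ} → (Fin n → ℚ) → ℚ
sumFin {zero}  f = 0ℚ
sumFin {suc n} f = f fzero + sumFin (λ i → f (fsuc i))

-- An instance of the incremental knapsack problem with T periods and N items.
-- Periods are indexed by Fin T, i.e. paper period t corresponds to index t-1.
record Instance (T N : ℕ) : Set where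
  field
    B : Fin T → ℚ
    Δ : Fin T → ℚ
    v : Fin N → ℚ
    w : Fin N → ℚ
    B-mono : (s t : Fin T) → toℕ s N.≤ toℕ t → B s ≤ B t
    Δ-pos : (t : Fin T) → 0ℚ < Δ t
    v-pos : (i : Fin N) → 0ℚ < v i
    w-pos : (i : Fin N) → 0ℚ < w i

Solution : ℕ → ℕ → Set
Solution T N = Fin N → Fin T → Bool

ind : Bool → ℚ → ℚ
ind b q = if b then q else 0ℚ

module _ {T N : ℕ} (I : Instance T N) where
  open Instance I

  weightAt : Solution T N → Fin T → ℚ
  weightAt x t = sumFin (λ i → ind (x i t) (w i))

  periodValue : Solution T N → Fin T → ℚ
  periodValue x t = sumFin (λ i → ind (x i t) (v i * Δ t))

  value : Solution T N → ℚ
  value x = sumFin (periodValue x)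

  valueFrom : Solution T N → Fin T → ℚ
  valueFrom x t₀ = sumFin (λ t → ind (toℕ t₀ N.≤ᵇ toℕ t) (periodValue x t))

  valueBefore : Solution T N → Fin T → ℚ
  valueBefore x t₀ = sumFin (λ t → ind (suc (toℕ t) N.≤ᵇ toℕ t₀) (periodValue x t))

  record Feasible (x : Solution T N) : Set where
    field
      monotone : (i : Fin N) (s t : Fin T) → toℕ t ≡ suc (toℕ s) →
                 x i s B.≤ x i t
      capacity : (t : Fin T) → weightAt x t ≤ B t

  Optimal : Solution T N → Set
  Optimal x = Feasible x × ((y : Solution T N) → Feasible y → value y ≤ value x)

ReplicatedAt : {T N : ℕ} → Solution T N → Fin T → Set
ReplicatedAt {T} {N} x t̄ =
  ((i : Fin N) (t : Fin T) → toℕ t N.< toℕ t̄ → x i t ≡ false) ×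
  ((i : Fin N) (t : Fin T) → toℕ t̄ N.≤ toℕ t → x i t ≡ x i t̄)

-- Let P t be the value collected by x^Z in period t and c = V^Z / 3, so
-- P 1 + … + P T = 3c.
--
--  * If some period t̄ has c ≤ P t̄, freeze the knapsack x^Z takes at t̄ and
--    repeat it in every period from t̄ on (`replicateAt`).  Capacities are
--    nondecreasing, so this replicated solution is feasible, and its value is
--    at least its own value at t̄, namely P t̄ ≥ c.
--  * Otherwise every P t < c, and a lemma about rational sequences applies
--    (`balancedSplit`): let k be the first index with c ≤ P 1 + … + P (k+1).
--    Then P 1 + … + P (k+1) < 2c, so the tail from period k+2 carries more
--    than c; since a single period (or nothing) carries less than c, the tail
--    contains at least two periods, which is the required middle period.
module Submission where

open import Defs
open import Data.Nat using (ℕ; zero; suc; _≤ᵇ_; z≤n; s≤s)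
import Data.Nat as N
import Data.Nat.Properties as NP
open import Data.Fin using (Fin; toℕ; fromℕ<) renaming (zero to fzero; suc to fsuc)
open import Data.Fin.Properties using (toℕ-fromℕ<; any?)
open import Data.Bool using (Bool; true; false)
import Data.Bool as B
import Data.Bool.Properties as BP
open import Data.Integer using (+_)
open import Data.Rational using (ℚ; 0ℚ; 1ℚ; _/_; _+_; _*_; _≤_; _<_; positive)
open import Data.Rational.Properties
open import Data.Product using (Σ; _×_; _,_)
open import Data.Sum using (_⊎_; inj₁; inj₂)
open import Data.Empty using (⊥-elim)
open import Relation.Nullary using (¬_; Dec; yes; no)
open import Relation.Binary.PropositionalEquality

sumFin-zero : (n : ℕ) → sumFin {n} (λ _ → 0ℚ) ≡ 0ℚ
sumFin-zero zero    = refl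
sumFin-zero (suc n) = trans (+-identityˡ _) (sumFin-zero n)

sumFin-cong : {n : ℕ} {f g : Fin n → ℚ} → (∀ i → f i ≡ g i) → sumFin f ≡ sumFin g
sumFin-cong {zero}  e = refl
sumFin-cong {suc n} e = cong₂ _+_ (e fzero) (sumFin-cong (λ i → e (fsuc i)))

sumFin-nonneg : {n : ℕ} (f : Fin n → ℚ) → (∀ i → 0ℚ ≤ f i) → 0ℚ ≤ sumFin f
sumFin-nonneg {zero}  f h = ≤-refl
sumFin-nonneg {suc n} f h =
  subst (_≤ sumFin f) (+-identityˡ 0ℚ)
        (+-mono-≤ (h fzero) (sumFin-nonneg (λ i → f (fsuc i)) (λ i → h (fsuc i))))

term≤sumFin : {n : ℕ} (f : Fin n → ℚ) → (∀ i → 0ℚ ≤ f i) → (t : Fin n) → f t ≤ sumFin f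
term≤sumFin {suc n} f h fzero =
  subst (_≤ sumFin f) (+-identityʳ (f fzero))
        (+-mono-≤ (≤-refl {f fzero}) (sumFin-nonneg (λ i → f (fsuc i)) (λ i → h (fsuc i))))
term≤sumFin {suc n} f h (fsuc t) =
  subst (_≤ sumFin f) (+-identityˡ (f (fsuc t)))
        (+-mono-≤ (h fzero) (term≤sumFin (λ i → f (fsuc i)) (λ i → h (fsuc i)) t))

prefixSum : {n : ℕ} → (Fin n → ℚ) → ℕ → ℚ
prefixSum f k = sumFin (λ t → ind (suc (toℕ t) ≤ᵇ k) (f t))

suffixSum : {n : ℕ} → (Fin n → ℚ) → ℕ → ℚ
suffixSum f k = sumFin (λ t → ind (k ≤ᵇ toℕ t) (f t))

prefixSum-zero : {n : ℕ} (f : Fin n → ℚ) → prefixSum f 0 ≡ 0ℚ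
prefixSum-zero {n} f = sumFin-zero n

prefixSum-all : (n : ℕ) (f : Fin n → ℚ) → prefixSum f n ≡ sumFin f
prefixSum-all zero    f = refl
prefixSum-all (suc n) f = cong (_+_ (f fzero)) (prefixSum-all n (λ i → f (fsuc i)))

prefixSum-step : {n : ℕ} (f : Fin n → ℚ) (t : Fin n) →
                 prefixSum f (suc (toℕ t)) ≡ prefixSum f (toℕ t) + f t
prefixSum-step {suc n} f fzero = begin
  f fzero + prefixSum f′ 0    ≡⟨ cong (_+_ (f fzero)) (prefixSum-zero f′) ⟩
  f fzero + 0ℚ                ≡⟨ +-comm (f fzero) 0ℚ ⟩
  0ℚ + f fzero                ≡⟨ cong (_+ f fzero) (sym (trans (+-identityˡ (prefixSum f′ 0)) (prefixSum-zero f′))) ⟩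
  0ℚ + prefixSum f′ 0 + f fzero  ∎
  where open ≡-Reasoning
        f′ : Fin n → ℚ
        f′ i = f (fsuc i)
prefixSum-step {suc n} f (fsuc t) =
  trans (cong (_+_ (f fzero)) (prefixSum-step (λ i → f (fsuc i)) t))
        (sym (+-assoc (f fzero) _ _))

suffixSum-shift : {n : ℕ} (f : Fin (suc n) → ℚ) (k : ℕ) →
                  suffixSum f (suc k) ≡ suffixSum (λ i → f (fsuc i)) k
suffixSum-shift f k = trans (+-identityˡ _) (sumFin-cong λ i → cong (λ b → ind b (f (fsuc i))) (≤ᵇ-suc k (toℕ i)))
  where
  ≤ᵇ-suc : (a b : ℕ) → (suc a ≤ᵇ suc b) ≡ (a ≤ᵇ b)
  ≤ᵇ-suc zero    b = refl
  ≤ᵇ-suc (suc a) b = refl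

suffixSum-empty : {n : ℕ} (f : Fin n → ℚ) (k : ℕ) → n N.≤ k → suffixSum f k ≡ 0ℚ
suffixSum-empty {zero}  f k       n≤k       = refl
suffixSum-empty {suc n} f (suc k) (s≤s n≤k) =
  trans (suffixSum-shift f k) (suffixSum-empty (λ i → f (fsuc i)) k n≤k)

suffixSum-step : {n : ℕ} (f : Fin n → ℚ) (t : Fin n) →
                 suffixSum f (toℕ t) ≡ f t + suffixSum f (suc (toℕ t))
suffixSum-step {suc n} f fzero = cong (_+_ (f fzero)) (sym (+-identityˡ _))
suffixSum-step {suc n} f (fsuc t) = begin
  suffixSum f (suc (toℕ t))                  ≡⟨ suffixSum-shift f (toℕ t) ⟩
  suffixSum f′ (toℕ t)                       ≡⟨ suffixSum-step f′ t ⟩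
  f′ t + suffixSum f′ (suc (toℕ t))          ≡⟨ cong (_+_ (f′ t)) (sym (suffixSum-shift f (suc (toℕ t)))) ⟩
  f (fsuc t) + suffixSum f (suc (suc (toℕ t)))  ∎
  where open ≡-Reasoning
        f′ : Fin n → ℚ
        f′ i = f (fsuc i)

prefix+suffix : {n : ℕ} (f : Fin n → ℚ) (k : ℕ) → prefixSum f k + suffixSum f k ≡ sumFin f
prefix+suffix {zero}  f k       = refl
prefix+suffix {suc n} f zero    = trans (cong (_+ sumFin f) (prefixSum-zero f)) (+-identityˡ _)
prefix+suffix {suc n} f (suc k) = begin
  f fzero + prefixSum f′ k + suffixSum f (suc k)  ≡⟨ +-assoc (f fzero) _ _ ⟩
  f fzero + (prefixSum f′ k + suffixSum f (suc k))  ≡⟨ cong (λ s → f fzero + (prefixSum f′ k + s)) (suffixSum-shift f k) ⟩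
  f fzero + (prefixSum f′ k + suffixSum f′ k)     ≡⟨ cong (_+_ (f fzero)) (prefix+suffix f′ k) ⟩
  sumFin f                                         ∎
  where open ≡-Reasoning
        f′ : Fin n → ℚ
        f′ i = f (fsuc i)

firstCrossing : (Q : ℕ → Set) → ((k : ℕ) → Dec (Q k)) → ¬ Q 0 → (n : ℕ) → Q n →
                Σ ℕ λ k → suc k N.≤ n × ¬ Q k × Q (suc k)
firstCrossing Q Q? ¬Q0 zero    Qn = ⊥-elim (¬Q0 Qn)
firstCrossing Q Q? ¬Q0 (suc m) Qn with Q? m
... | no ¬Qm = m , NP.≤-refl , ¬Qm , Qn
... | yes Qm with firstCrossing Q Q? ¬Q0 m Qm
...   | k , k<m , ¬Qk , Qk+1 = k , NP.m≤n⇒m≤1+n k<m , ¬Qk , Qk+1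

suffixBig⇒twoTerms : {n : ℕ} (f : Fin n → ℚ) (c : ℚ) → 0ℚ < c → (∀ t → f t < c) →
                     (m : ℕ) → c < suffixSum f m → suc m N.< n
suffixBig⇒twoTerms {n} f c 0<c small m c<suffix with suc m N.<? n
... | yes m+1<n = m+1<n
... | no m+1≮n with m N.<? n
...   | no m≮n = ⊥-elim (<-asym 0<c
          (subst (c <_) (suffixSum-empty f m (NP.≮⇒≥ m≮n)) c<suffix))
...   | yes m<n = ⊥-elim (<-asym (small t) (subst (c <_) suffix≡last c<suffix))
  where
  t : Fin n
  t = fromℕ< m<n
  open ≡-Reasoning
  suffix≡last : suffixSum f m ≡ f t
  suffix≡last = begin
    suffixSum f m                    ≡⟨ cong (suffixSum f) (sym (toℕ-fromℕ< m<n)) ⟩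
    suffixSum f (toℕ t)              ≡⟨ suffixSum-step f t ⟩
    f t + suffixSum f (suc (toℕ t))  ≡⟨ cong (_+_ (f t)) (suffixSum-empty f _
                                          (subst (λ j → n N.≤ suc j) (sym (toℕ-fromℕ< m<n)) (NP.≮⇒≥ m+1≮n))) ⟩
    f t + 0ℚ                         ≡⟨ +-identityʳ (f t) ⟩
    f t                              ∎

balancedSplit : {n : ℕ} (f : Fin n → ℚ) (c : ℚ) → 0ℚ < c → (∀ t → f t < c) →
                c + c + c ≡ sumFin f →
                Σ (Fin n) λ t → 1 N.≤ toℕ t × suc (toℕ t) N.< n ×
                                c ≤ suffixSum f (toℕ t) × c ≤ prefixSum f (toℕ t)
balancedSplit {n} f c 0<c small total with firstCrossing Q (λ k → c ≤? prefixSum f k) ¬Q0 n Qn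
  where
  Q : ℕ → Set
  Q k = c ≤ prefixSum f k
  ¬Q0 : ¬ Q 0
  ¬Q0 c≤0 = <-irrefl refl (<-≤-trans 0<c (subst (c ≤_) (prefixSum-zero f) c≤0))
  Qn : Q n
  Qn = subst (c ≤_) (sym (trans (prefixSum-all n f) (sym total)))
             (subst (_≤ c + c + c) (trans (cong (_+ c) (+-identityˡ 0ℚ)) (+-identityˡ c))
                    (+-mono-≤ (+-mono-≤ (<⇒≤ 0<c) (<⇒≤ 0<c)) ≤-refl))
... | k , k<n , c≰prefix , c≤prefix′ =
  split , subst (1 N.≤_) k+1≡split (s≤s z≤n) , subst (λ j → suc j N.< n) k+1≡split k+2<n ,
  subst (λ j → c ≤ suffixSum f j) k+1≡split (<⇒≤ c<suffix) ,
  subst (λ j → c ≤ prefixSum f j) k+1≡split c≤prefix′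
  where
  t : Fin n
  t = fromℕ< k<n
  prefix<2c : prefixSum f (suc k) < c + c
  prefix<2c = subst (_< c + c)
    (sym (subst (λ j → prefixSum f (suc j) ≡ prefixSum f j + f t) (toℕ-fromℕ< k<n) (prefixSum-step f t)))
    (+-mono-< (≰⇒> c≰prefix) (small t))
  c<suffix : c < suffixSum f (suc k)
  c<suffix = ≰⇒> λ suffix≤c → <-irrefl refl
    (subst₂ _<_ (prefix+suffix f (suc k)) total (+-mono-<-≤ prefix<2c suffix≤c))
  k+2<n : suc (suc k) N.< n
  k+2<n = suffixBig⇒twoTerms f c 0<c small (suc k) c<suffix
  split : Fin n
  split = fromℕ< (NP.<-trans (NP.n<1+n (suc k)) k+2<n)
  k+1≡split : suc k ≡ toℕ split
  k+1≡split = sym (toℕ-fromℕ< _)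

thirds : (V : ℚ) → (+ 1 / 3) * V + (+ 1 / 3) * V + (+ 1 / 3) * V ≡ V
thirds V = begin
  (+ 1 / 3) * V + (+ 1 / 3) * V + (+ 1 / 3) * V  ≡⟨ cong (_+ (+ 1 / 3) * V) (sym (*-distribʳ-+ V (+ 1 / 3) (+ 1 / 3))) ⟩
  ((+ 1 / 3) + (+ 1 / 3)) * V + (+ 1 / 3) * V    ≡⟨ sym (*-distribʳ-+ V ((+ 1 / 3) + (+ 1 / 3)) (+ 1 / 3)) ⟩
  1ℚ * V                                         ≡⟨ *-identityˡ V ⟩
  V                                              ∎
  where open ≡-Reasoning

module _ {T N : ℕ} (I : Instance T N) where
  open Instance I

  periodValue-nonneg : (x : Solution T N) (t : Fin T) → 0ℚ ≤ periodValue I x t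
  periodValue-nonneg x t = sumFin-nonneg _ λ i → indNonneg (x i t)
    where
    v*Δ-nonneg : (i : Fin N) → 0ℚ ≤ v i * Δ t
    v*Δ-nonneg i = <⇒≤ (positive⁻¹ (v i * Δ t)
      {{pos*pos⇒pos (v i) {{positive (v-pos i)}} (Δ t) {{positive (Δ-pos t)}}}})
    indNonneg : {i : Fin N} (b : Bool) → 0ℚ ≤ ind b (v i * Δ t)
    indNonneg         false = ≤-refl
    indNonneg {i = i} true  = v*Δ-nonneg i

  replicateAt : Solution T N → Fin T → Solution T N
  replicateAt x t̄ i t = keepIf (toℕ t̄ N.≤? toℕ t) (x i t̄)
    where
    keepIf : {A : Set} → Dec A → Bool → Bool
    keepIf (yes _) b = b
    keepIf (no _)  _ = false

  replicate-before : (x : Solution T N) (t̄ t : Fin T) (i : Fin N) →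
                     toℕ t N.< toℕ t̄ → replicateAt x t̄ i t ≡ false
  replicate-before x t̄ t i t<t̄ with toℕ t̄ N.≤? toℕ t
  ... | yes t̄≤t = ⊥-elim (NP.<⇒≱ t<t̄ t̄≤t)
  ... | no  _   = refl

  replicate-after : (x : Solution T N) (t̄ t : Fin T) (i : Fin N) →
                    toℕ t̄ N.≤ toℕ t → replicateAt x t̄ i t ≡ x i t̄
  replicate-after x t̄ t i t̄≤t with toℕ t̄ N.≤? toℕ t
  ... | yes _    = refl
  ... | no  t̄≰t = ⊥-elim (t̄≰t t̄≤t)

  replicate-replicated : (x : Solution T N) (t̄ : Fin T) → ReplicatedAt (replicateAt x t̄) t̄
  replicate-replicated x t̄ =
      (λ i t t<t̄ → replicate-before x t̄ t i t<t̄)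
    , (λ i t t̄≤t → trans (replicate-after x t̄ t i t̄≤t) (sym (replicate-after x t̄ t̄ i NP.≤-refl)))

  -- Periods before t̄ are empty; from t̄ on the load is that of x at t̄,
  -- which fits because x is feasible at t̄ and capacities only grow.
  replicate-feasible : (x : Solution T N) → Feasible I x → (t̄ : Fin T) →
                       Feasible I (replicateAt x t̄)
  replicate-feasible x feas t̄ = record { monotone = monotone′ ; capacity = capacity′ }
    where
    open Feasible feas
    monotone′ : (i : Fin N) (s t : Fin T) → toℕ t ≡ suc (toℕ s) →
                replicateAt x t̄ i s B.≤ replicateAt x t̄ i t
    monotone′ i s t t≡s+1 with toℕ t̄ N.≤? toℕ s
    ... | no  _    = BP.≤-minimum _
    ... | yes t̄≤s rewrite replicate-after x t̄ t i
                            (NP.≤-trans t̄≤s (subst (toℕ s N.≤_) (sym t≡s+1) (NP.n≤1+n _))) = B.b≤b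
    capacity′ : (t : Fin T) → weightAt I (replicateAt x t̄) t ≤ B t
    capacity′ t with toℕ t̄ N.≤? toℕ t
    ... | yes t̄≤t = ≤-trans (capacity t̄) (B-mono t̄ t t̄≤t)
    ... | no  _    = subst (_≤ B t) (sym (sumFin-zero N))
                          (≤-trans (sumFin-nonneg _ weight-nonneg) (capacity t))
      where
      weight-nonneg : (i : Fin N) → 0ℚ ≤ ind (x i t) (w i)
      weight-nonneg i with x i t
      ... | false = ≤-refl
      ... | true  = <⇒≤ (w-pos i)

  replicate-value : (x : Solution T N) (t̄ : Fin T) →
                    periodValue I x t̄ ≤ value I (replicateAt x t̄)
  replicate-value x t̄ =
    subst (_≤ value I (replicateAt x t̄))
          (sumFin-cong λ i → cong (λ b → ind b (v i * Δ t̄)) (replicate-after x t̄ t̄ i NP.≤-refl))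
          (term≤sumFin (periodValue I (replicateAt x t̄)) (periodValue-nonneg (replicateAt x t̄)) t̄)

  splitOrReplicate : (x : Solution T N) → Feasible I x → 1 N.≤ T →
    (c : ℚ) → c + c + c ≡ value I x →
    (Σ (Fin T) λ t₃ → 1 N.≤ toℕ t₃ × suc (toℕ t₃) N.< T ×
        (c ≤ valueFrom I x t₃) × (c ≤ valueBefore I x t₃))
    ⊎
    (Σ (Fin T) λ t̄ → Σ (Solution T N) λ x̄ →
        ReplicatedAt x̄ t̄ × Feasible I x̄ × (c ≤ value I x̄))
  splitOrReplicate x feasible 1≤T c total with any? (λ t → c ≤? periodValue I x t)
  ... | yes (t̄ , c≤Pt̄) =
    inj₂ (t̄ , replicateAt x t̄ , replicate-replicated x t̄ , replicate-feasible x feasible t̄ ,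
          ≤-trans c≤Pt̄ (replicate-value x t̄))
  ... | no noneLarge = inj₁ (balancedSplit (periodValue I x) c 0<c small total)
    where
    small : ∀ t → periodValue I x t < c
    small t = ≰⇒> λ c≤Pt → noneLarge (t , c≤Pt)
    0<c : 0ℚ < c
    0<c = ≤-<-trans (periodValue-nonneg x (fromℕ< 1≤T)) (small (fromℕ< 1≤T))

lemma3 : (T N : ℕ) → 1 N.≤ T → (I : Instance T N) → (xZ : Solution T N) →
    Optimal I xZ →
    (Σ (Fin T) λ t3 → 1 N.≤ toℕ t3 × suc (toℕ t3) N.< T ×
    ((+ 1 / 3) * value I xZ ≤ valueFrom I xZ t3) ×
    ((+ 1 / 3) * value I xZ ≤ valueBefore I xZ t3))
    ⊎
    (Σ (Fin T) λ tbar → Σ (Solution T N) λ xbar →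
    ReplicatedAt xbar tbar × Feasible I xbar ×
    ((+ 1 / 3) * value I xZ ≤ value I xbar))
lemma3 T N 1≤T I xZ (feasible , _) =
  splitOrReplicate I xZ feasible 1≤T ((+ 1 / 3) * value I xZ) (thirds (value I xZ))
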